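{- Let $h\ge 2$ and $n\ge 1$ be integers and let $H$ be an $h$-uniform hypergraph. If $H$ is $n$-e.c., then for each vertex $v\in V(H)$, the hypergraphs $H-v$ and $H[N(v)]$ are $(n-1)$-e.c.
   Context: A hypergraph $H=(V,E)$ consists of a finite vertex set $V$ and a collection $E$ of subsets of $V$ (edges); it is $h$-uniform if every edge has exactly $h$ vertices. For a positive integer $n$, an $h$-uniform hypergraph $H$ is $n$-existentially closed ($n$-e.c.) if for every set $S\subseteq V(H)$ with $|S|=n$ and every $T\subseteq S$, there is a set $X\subseteq V(H)\setminus S$ with $|X|=h-1$ such that $X\cup\{z\}$ is an edge of $H$ for every $z\in T$ and $X\cup\{s\}$ is not an edge of $H$ for every $s\in S\setminus T$. For $Y\subseteq V(H)$, the induced subgraph $H[Y]$ is the hypergraph with vertex set $Y$ whose edges are the edges of $H$ contained in $Y$; $H-v$ denotes $H[V(H)\setminus\{v\}]$. The neighbourhood $N(v)$ of a vertex $v$ is the set of vertices that occur together with $v$ in at least one edge of $H$. -}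

module Defs where

open import Level using (0ℓ)
open import Data.Nat using (ℕ; _∸_)
open import Data.Fin using (Fin)
open import Data.Fin.Subset using (Subset; _∈_; _∉_; _∪_; ⁅_⁆; ∣_∣)
open import Data.Product using (Σ; _×_; ∃)
open import Relation.Nullary using (¬_)
open import Relation.Unary using (Pred)
open import Relation.Binary.PropositionalEquality using (_≡_; _≢_)

-- A finite hypergraph whose vertices form a set V ⊆ Fin m (ambient universe),
-- and whose edges are subsets of V (given by a predicate on subsets of Fin m).
record Hypergraph (m : ℕ) : Set₁ where
  field
    V   : Pred (Fin m) 0ℓ
    E   : Subset m → Set
    E⊆V : ∀ {e} → E e → ∀ x → x ∈ e → V x
open Hypergraph public

_⊆V_ : ∀ {m} → Subset m → Pred (Fin m) 0ℓ → Set
A ⊆V Y = ∀ x → x ∈ A → Y x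

Uniform : ∀ {m} → ℕ → Hypergraph m → Set
Uniform h H = ∀ e → E H e → ∣ e ∣ ≡ h

ExistClosed : ∀ {m} → (h n : ℕ) → Hypergraph m → Set
ExistClosed {m} h n H =
  ∀ (S : Subset m) → S ⊆V V H → ∣ S ∣ ≡ n →
  ∀ (T : Subset m) → (∀ x → x ∈ T → x ∈ S) →
  Σ (Subset m) λ X →
    X ⊆V V H × (∀ x → x ∈ X → x ∉ S) × ∣ X ∣ ≡ h ∸ 1 ×
    (∀ z → z ∈ T → E H (X ∪ ⁅ z ⁆)) ×
    (∀ s → s ∈ S → s ∉ T → ¬ E H (X ∪ ⁅ s ⁆))

Induced : ∀ {m} → Hypergraph m → Pred (Fin m) 0ℓ → Hypergraph m
Induced H Y = record
  { V = Y
  ; E = λ e → E H e × e ⊆V Y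
  ; E⊆V = λ p → Data.Product.proj₂ p }

Delete : ∀ {m} → Hypergraph m → Fin m → Hypergraph m
Delete H v = Induced H (λ x → V H x × x ≢ v)

Nbhd : ∀ {m} → Hypergraph m → Fin m → Pred (Fin m) 0ℓ
Nbhd H v x = ∃ λ e → E H e × v ∈ e × x ∈ e × x ≢ v

-- Given an (n-1)-set S in H - v or in H[N(v)], apply n-existential closure of H to S ∪ {v}.
-- The witness X avoids v, so it lives in H - v.  For H[N(v)] we moreover ask that v be
-- joined to X; then X ∪ {v} is an edge of H, which places X inside N(v).
module Submission where

open import Defs
open import Level using (0ℓ)
open import Data.Nat using (ℕ; _≤_; _∸_; suc)
open import Data.Fin using (Fin; zero; suc)
open import Data.Bool using (true; false)
open import Data.Vec using (_∷_; here; there)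
open import Data.Fin.Subset using (Subset; _∈_; _∉_; _⊆_; _∪_; ⁅_⁆; ∣_∣)
open import Data.Fin.Subset.Properties
  using (∪-identityʳ; x∈⁅x⁆; x∈⁅y⁆⇒x≡y; x∈p∪q⁻; p⊆p∪q; q⊆p∪q)
open import Data.Product using (Σ; _×_; _,_; proj₁; proj₂)
open import Data.Sum using (_⊎_; inj₁; inj₂)
open import Data.Empty using (⊥-elim)
open import Relation.Nullary using (¬_)
open import Relation.Unary using (Pred)
open import Relation.Binary.PropositionalEquality using (_≡_; _≢_; refl; cong; trans)

x∉p⇒∣p∪⁅x⁆∣≡suc∣p∣ : ∀ {k} (p : Subset k) (x : Fin k) → x ∉ p → ∣ p ∪ ⁅ x ⁆ ∣ ≡ suc ∣ p ∣
x∉p⇒∣p∪⁅x⁆∣≡suc∣p∣ (true  ∷ p) zero    x∉p = ⊥-elim (x∉p here)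
x∉p⇒∣p∪⁅x⁆∣≡suc∣p∣ (false ∷ p) zero    x∉p = cong suc (cong ∣_∣ (∪-identityʳ p))
x∉p⇒∣p∪⁅x⁆∣≡suc∣p∣ (true  ∷ p) (suc x) x∉p =
  cong suc (x∉p⇒∣p∪⁅x⁆∣≡suc∣p∣ p x (λ x∈p → x∉p (there x∈p)))
x∉p⇒∣p∪⁅x⁆∣≡suc∣p∣ (false ∷ p) (suc x) x∉p =
  x∉p⇒∣p∪⁅x⁆∣≡suc∣p∣ p x (λ x∈p → x∉p (there x∈p))

module _ {k : ℕ} where

  x∈p∪⁅y⁆⁻ : ∀ {p : Subset k} {x y} → x ∈ p ∪ ⁅ y ⁆ → x ∈ p ⊎ x ≡ y
  x∈p∪⁅y⁆⁻ {p} {y = y} x∈p∪⁅y⁆ with x∈p∪q⁻ p ⁅ y ⁆ x∈p∪⁅y⁆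
  ... | inj₁ x∈p   = inj₁ x∈p
  ... | inj₂ x∈⁅y⁆ = inj₂ (x∈⁅y⁆⇒x≡y y x∈⁅y⁆)

  y∈p∪⁅y⁆ : ∀ (p : Subset k) y → y ∈ p ∪ ⁅ y ⁆
  y∈p∪⁅y⁆ p y = q⊆p∪q p ⁅ y ⁆ (x∈⁅x⁆ y)

  ⊆V-∪⁅⁆ : ∀ {p : Subset k} {Y : Pred (Fin k) 0ℓ} {y} → p ⊆V Y → Y y → (p ∪ ⁅ y ⁆) ⊆V Y
  ⊆V-∪⁅⁆ {p} p⊆Y Yy x x∈p∪⁅y⁆ with x∈p∪⁅y⁆⁻ {p = p} x∈p∪⁅y⁆
  ... | inj₁ x∈p = p⊆Y x x∈p
  ... | inj₂ refl = Yy

Witness : ∀ {m} → ℕ → Hypergraph m → (S T X : Subset m) → Set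
Witness h H S T X =
  X ⊆V V H × (∀ x → x ∈ X → x ∉ S) × ∣ X ∣ ≡ h ∸ 1 ×
  (∀ z → z ∈ T → E H (X ∪ ⁅ z ⁆)) ×
  (∀ s → s ∈ S → s ∉ T → ¬ E H (X ∪ ⁅ s ⁆))

module _ {m : ℕ} {h : ℕ} (H : Hypergraph m) where

  witness-induced : ∀ {Y : Pred (Fin m) 0ℓ} {S T S′ T′ X} →
    S ⊆ S′ → T ⊆ T′ → (∀ {s} → s ∈ S → s ∉ T → s ∉ T′) →
    X ⊆V Y → T ⊆V Y → Witness h H S′ T′ X → Witness h (Induced H Y) S T X
  witness-induced {T = T} {X = X} S⊆S′ T⊆T′ s∉T⇒s∉T′ X⊆Y T⊆Y
                  (_ , X∩S′≡∅ , ∣X∣≡h-1 , edges , non-edges) =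
      X⊆Y
    , (λ x x∈X x∈S → X∩S′≡∅ x x∈X (S⊆S′ x∈S))
    , ∣X∣≡h-1
    , (λ z z∈T → edges z (T⊆T′ z∈T) , ⊆V-∪⁅⁆ {p = X} X⊆Y (T⊆Y z z∈T))
    , (λ s s∈S s∉T e → non-edges s (S⊆S′ s∈S) (s∉T⇒s∉T′ s∈S s∉T) (proj₁ e))

  witness-at-∪⁅⁆ : ∀ {n} → 1 ≤ n → ExistClosed h n H →
    ∀ {S T v} → S ⊆V V H → v ∉ S → V H v → ∣ S ∣ ≡ n ∸ 1 → T ⊆ S ∪ ⁅ v ⁆ →
    Σ (Subset m) (Witness h H (S ∪ ⁅ v ⁆) T)
  witness-at-∪⁅⁆ {suc n} _ ec {S} {T} {v} S⊆V v∉S Vv ∣S∣≡n T⊆S∪⁅v⁆ =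
    ec (S ∪ ⁅ v ⁆) (⊆V-∪⁅⁆ {p = S} S⊆V Vv)
       (trans (x∉p⇒∣p∪⁅x⁆∣≡suc∣p∣ S v v∉S) (cong suc ∣S∣≡n))
       T (λ x → T⊆S∪⁅v⁆)

  module _ {n : ℕ} (n≥1 : 1 ≤ n) (ec : ExistClosed h n H) (v : Fin m) (Vv : V H v) where

    delete-existClosed : ExistClosed h (n ∸ 1) (Delete H v)
    delete-existClosed S S⊆V-v ∣S∣≡n-1 T T⊆S =
      let X , w = witness-at-∪⁅⁆ n≥1 ec S⊆V v∉S Vv ∣S∣≡n-1 (λ t → p⊆p∪q ⁅ v ⁆ (T⊆S _ t))
          X⊆V , X∩S∪⁅v⁆≡∅ , _ = w
          X⊆V-v : X ⊆V (λ x → V H x × x ≢ v)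
          X⊆V-v x x∈X = X⊆V x x∈X , λ { refl → X∩S∪⁅v⁆≡∅ v x∈X (y∈p∪⁅y⁆ S v) }
      in X , witness-induced (p⊆p∪q ⁅ v ⁆) (λ t → t) (λ _ s∉T → s∉T)
                             X⊆V-v (λ z z∈T → S⊆V-v z (T⊆S z z∈T)) w
      where
      S⊆V : S ⊆V V H
      S⊆V x x∈S = proj₁ (S⊆V-v x x∈S)
      v∉S : v ∉ S
      v∉S v∈S = proj₂ (S⊆V-v v v∈S) refl

    neighbourhood-existClosed : ExistClosed h (n ∸ 1) (Induced H (Nbhd H v))
    neighbourhood-existClosed S S⊆N ∣S∣≡n-1 T T⊆S =
      let X , w = witness-at-∪⁅⁆ n≥1 ec S⊆V v∉S Vv ∣S∣≡n-1 T∪⁅v⁆⊆S∪⁅v⁆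
          _ , X∩S∪⁅v⁆≡∅ , _ , edges , _ = w
          X⊆N : X ⊆V Nbhd H v
          X⊆N x x∈X = X ∪ ⁅ v ⁆ , edges v (y∈p∪⁅y⁆ T v) , y∈p∪⁅y⁆ X v , p⊆p∪q ⁅ v ⁆ x∈X
                    , λ { refl → X∩S∪⁅v⁆≡∅ v x∈X (y∈p∪⁅y⁆ S v) }
      in X , witness-induced (p⊆p∪q ⁅ v ⁆) (p⊆p∪q ⁅ v ⁆) s∉T⇒s∉T∪⁅v⁆
                             X⊆N (λ z z∈T → S⊆N z (T⊆S z z∈T)) w
      where
      S⊆V : S ⊆V V H
      S⊆V x x∈S = let _ , e∈E , _ , x∈e , _ = S⊆N x x∈S in E⊆V H e∈E x x∈e
      v∉S : v ∉ S
      v∉S v∈S = let _ , _ , _ , _ , v≢v = S⊆N v v∈S in v≢v refl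
      T∪⁅v⁆⊆S∪⁅v⁆ : T ∪ ⁅ v ⁆ ⊆ S ∪ ⁅ v ⁆
      T∪⁅v⁆⊆S∪⁅v⁆ t with x∈p∪⁅y⁆⁻ {p = T} t
      ... | inj₁ x∈T  = p⊆p∪q ⁅ v ⁆ (T⊆S _ x∈T)
      ... | inj₂ refl = y∈p∪⁅y⁆ S v
      s∉T⇒s∉T∪⁅v⁆ : ∀ {s} → s ∈ S → s ∉ T → s ∉ T ∪ ⁅ v ⁆
      s∉T⇒s∉T∪⁅v⁆ s∈S s∉T s∈T∪⁅v⁆ with x∈p∪⁅y⁆⁻ {p = T} s∈T∪⁅v⁆
      ... | inj₁ s∈T  = s∉T s∈T
      ... | inj₂ refl = v∉S s∈S

theorem5 : ∀ {m : ℕ} (h n : ℕ) → 2 ≤ h → 1 ≤ n →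
    (H : Hypergraph m) → Uniform h H → ExistClosed h n H →
    ∀ (v : Fin m) → V H v →
    ExistClosed h (n ∸ 1) (Delete H v) × ExistClosed h (n ∸ 1) (Induced H (Nbhd H v))
theorem5 h n _ n≥1 H _ ec v Vv =
  delete-existClosed {h = h} H n≥1 ec v Vv , neighbourhood-existClosed {h = h} H n≥1 ec v Vv
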